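{- Let $\mathcal T=\{T_1,T_2\}$ be a set of two tiles and let $\ell,k$ be positive integers. Let $\bar M^R,\bar M^G,\bar M^Y$ be three $\mathcal T$-tilings of the $\ell\times k$ grid (block), and let $\bar r^{c,d}\in\mathbb N^\ell$, $\bar s^{c,d}\in\mathbb N^k$ denote the $T_d$-row and $T_d$-column projections of $\bar M^c$, for $c\in\{R,G,Y\}$, $d\in\{1,2\}$. Assume (first requirement) that $\bar r^{R,1},\bar r^{G,1},\bar r^{Y,1}$ are affinely independent and $\bar s^{R,1},\bar s^{G,1},\bar s^{Y,1}$ are affinely independent. Let $(r^R,r^G,r^Y,s^R,s^G,s^Y)$ be an instance of the 3-color tomography problem on an $m\times n$ grid, and define the $\mathcal T$-tiling tomography instance on the $m\ell\times nk$ grid with projections, for $1\le i\le\ell$, $1\le j\le k$, $1\le x\le m$, $1\le y\le n$, $d\in\{1,2\}$, $$r^d_{x\ell-\ell+i}=\sum_{c\in\{R,G,Y\}} r^c_x\,\bar r^{c,d}_i,\qquad s^d_{yk-k+j}=\sum_{c\in\{R,G,Y\}} s^c_y\,\bar s^{c,d}_j.$$ Assume (second requirement) that in every solution $\bar M$ of this tiling instance, when the $m\ell\times nk$ grid is partitioned into $mn$ blocks of size $\ell\times k$, every block of $\bar M$ is one of $\bar M^R,\bar M^G,\bar M^Y$ or has the same $T_1$- and $T_2$-row and column projections as one of them. Then the $\mathcal T$-tiling instance has a solution if and only if the 3-color tomography instance has a solution.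
   Context: Tiles, shifts $T+(i',j')$, tilings and the tiling tomography problem: a tile is a finite 4-connected set of cells; a solution of a tiling tomography instance with tiles $T_1,\dots,T_k$ on an $m\times n$ grid with projections $r^d,s^d$ is a matrix $M\in\{0,\dots,k\}^{m\times n}$ such that the shifted tiles $T_d+(i,j)$ with $M_{ij}=d\ne0$ are disjoint and cover the grid exactly, and $r^d_i=|\{j:M_{ij}=d\}|$, $s^d_j=|\{i:M_{ij}=d\}|$. A $\mathcal T$-tiling of the $\ell\times k$ block is such a matrix for the block, and its $T_d$-projections are the corresponding counts. The 3-color tomography problem: given $r^c\in\mathbb N^m$, $s^c\in\mathbb N^n$ for $c\in\{R,G,Y\}$ with $\sum_c r^c_i=n$, $\sum_c s^c_j=m$, $\sum_i r^c_i=\sum_j s^c_j$, find $M\in\{R,G,Y\}^{m\times n}$ with $|\{j:M_{ij}=c\}|=r^c_i$, $|\{i:M_{ij}=c\}|=s^c_j$. -}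

module Defs where

open import Data.Nat using (ℕ; zero; suc; _+_; _*_; _≤_)
open import Data.Integer as ℤ using (ℤ; +_)
open import Data.Fin using (Fin; zero; suc; toℕ; _≟_; combine; remQuot)
open import Data.Bool using (Bool; true; false; if_then_else_)
open import Data.Product using (Σ; ∃; _×_; _,_; proj₁; proj₂)
open import Data.List using (List; _∷_; [])
open import Data.List.Membership.Propositional using (_∈_)
open import Relation.Nullary.Decidable using (⌊_⌋)
open import Relation.Binary.PropositionalEquality using (_≡_)
open import Function.Bundles using (_⇔_)

sumFin : ∀ {n} → (Fin n → ℕ) → ℕ
sumFin {zero}  f = 0
sumFin {suc n} f = f zero + sumFin (λ i → f (suc i))

countFin : ∀ {n} → (Fin n → Bool) → ℕ
countFin f = sumFin (λ i → if f i then 1 else 0)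

Cell : Set
Cell = ℤ × ℤ

_+c_ : Cell → Cell → Cell
(a , b) +c (c , d) = (a ℤ.+ c , b ℤ.+ d)

_-c_ : Cell → Cell → Cell
(a , b) -c (c , d) = (a ℤ.- c , b ℤ.- d)

Adj : Cell → Cell → Set
Adj (a , b) (c , d) =
  (a ≡ c × (d ≡ b ℤ.+ ℤ.1ℤ ⊎' b ≡ d ℤ.+ ℤ.1ℤ)) ⊎' (b ≡ d × (c ≡ a ℤ.+ ℤ.1ℤ ⊎' a ≡ c ℤ.+ ℤ.1ℤ))
  where open import Data.Sum using () renaming (_⊎_ to _⊎'_)

data PathIn (T : List Cell) (a : Cell) : Cell → Set where
  here : a ∈ T → PathIn T a a
  step : ∀ {b c} → PathIn T a b → c ∈ T → Adj b c → PathIn T a c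

record Tile : Set where
  field
    cells     : List Cell
    nonempty  : ∃ λ a → a ∈ cells
    connected : ∀ {a b} → a ∈ cells → b ∈ cells → PathIn cells a b
open Tile public

-- Tilings of an m × n grid by tiles T : Fin K → Tile.
-- A matrix M : Fin m → Fin n → Fin (suc K); the entry 0 means "no tile",
-- the entry suc d means the tile T d shifted by (i , j).

pos : ∀ {m n} → Fin m → Fin n → Cell
pos i j = (+ toℕ i , + toℕ j)

InGrid : ℕ → ℕ → Cell → Set
InGrid m n c = Σ (Fin m) λ i → Σ (Fin n) λ j → c ≡ pos i j

CoveredBy : ∀ {K m n} → (Fin K → Tile) → (Fin m → Fin n → Fin (suc K)) →
            Cell → Fin m → Fin n → Set
CoveredBy {K} T M c i j =
  Σ (Fin K) λ d → (M i j ≡ suc d) × ((c -c pos i j) ∈ cells (T d))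

IsTiling : ∀ {K} m n → (Fin K → Tile) → (Fin m → Fin n → Fin (suc K)) → Set
IsTiling {K} m n T M =
  (∀ i j (d : Fin K) → M i j ≡ suc d →
     ∀ t → t ∈ cells (T d) → InGrid m n (t +c pos i j))
  ×
  (∀ (x : Fin m) (y : Fin n) →
     Σ (Fin m) λ i → Σ (Fin n) λ j → CoveredBy T M (pos x y) i j ×
       (∀ i' j' → CoveredBy T M (pos x y) i' j' → (i' ≡ i) × (j' ≡ j)))

rowProj : ∀ {K m n} → (Fin m → Fin n → Fin (suc K)) → Fin K → Fin m → ℕ
rowProj M d i = countFin (λ j → ⌊ M i j ≟ suc d ⌋)

colProj : ∀ {K m n} → (Fin m → Fin n → Fin (suc K)) → Fin K → Fin n → ℕ
colProj M d j = countFin (λ i → ⌊ M i j ≟ suc d ⌋)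

IsTilingSolution : ∀ {K} m n → (Fin K → Tile) →
                   (Fin K → Fin m → ℕ) → (Fin K → Fin n → ℕ) →
                   (Fin m → Fin n → Fin (suc K)) → Set
IsTilingSolution m n T r s M =
  IsTiling m n T M × (∀ d i → rowProj M d i ≡ r d i) × (∀ d j → colProj M d j ≡ s d j)

-- 3-color tomography. Colors: zero = R, suc zero = G, suc (suc zero) = Y.

Color : Set
Color = Fin 3

Is3ColorInstance : ∀ m n → (Color → Fin m → ℕ) → (Color → Fin n → ℕ) → Set
Is3ColorInstance m n r s =
  (∀ i → sumFin (λ c → r c i) ≡ n) ×
  (∀ j → sumFin (λ c → s c j) ≡ m) ×
  (∀ c → sumFin (r c) ≡ sumFin (s c))

Is3ColorSolution : ∀ m n → (Color → Fin m → ℕ) → (Color → Fin n → ℕ) →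
                   (Fin m → Fin n → Color) → Set
Is3ColorSolution m n r s M =
  (∀ c i → countFin (λ j → ⌊ M i j ≟ c ⌋) ≡ r c i) ×
  (∀ c j → countFin (λ i → ⌊ M i j ≟ c ⌋) ≡ s c j)

AffinelyIndependent3 : ∀ {ℓ} → (Color → Fin ℓ → ℕ) → Set
AffinelyIndependent3 {ℓ} v =
  ∀ (λc : Color → ℤ) →
    (λc zero ℤ.+ λc (suc zero) ℤ.+ λc (suc (suc zero)) ≡ ℤ.0ℤ) →
    (∀ i → λc zero ℤ.* + v zero i ℤ.+ λc (suc zero) ℤ.* + v (suc zero) i
           ℤ.+ λc (suc (suc zero)) ℤ.* + v (suc (suc zero)) i ≡ ℤ.0ℤ) →
    ∀ c → λc c ≡ ℤ.0ℤ

-- The composed instance on the (m*ℓ) × (n*k) grid.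
-- Row index combine x i  (toℕ = x*ℓ + i) corresponds to x ℓ - ℓ + i (1-based).

bigRow : ∀ {m ℓ} → (Color → Fin m → ℕ) → (Color → Fin 2 → Fin ℓ → ℕ) →
         Fin 2 → Fin (m * ℓ) → ℕ
bigRow {m} {ℓ} r rb d p =
  let xi = remQuot {m} ℓ p in
  sumFin (λ c → r c (proj₁ xi) * rb c d (proj₂ xi))

bigCol : ∀ {n k} → (Color → Fin n → ℕ) → (Color → Fin 2 → Fin k → ℕ) →
         Fin 2 → Fin (n * k) → ℕ
bigCol {n} {k} s sb d p =
  let yj = remQuot {n} k p in
  sumFin (λ c → s c (proj₁ yj) * sb c d (proj₂ yj))

block : ∀ {A : Set} {m n ℓ k} → (Fin (m * ℓ) → Fin (n * k) → A) →
        Fin m → Fin n → Fin ℓ → Fin k → A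
block M x y i j = M (combine x i) (combine y j)

module Submission where

-- The (m*ℓ) × (n*k) grid is cut into m × n blocks of size ℓ × k; a cell
-- of the big grid is written  combine x i  (block row x, row i inside the
-- block), and every statement about cells is proved on such cells only
-- (all-combine).  The proof rests on three general facts.
--
--  * Assembly: placing a tiling of ℓ × k in every block yields a tiling
--    of the big grid (assemble-tiling), because translating a block by
--    its origin preserves shapes and no tile can leave its block.
--  * Counting: the T_d-row projection of a big row is the sum of the row
--    projections of the blocks it meets; if each block (x , y) looks like
--    the pattern of colour C x y, this sum is Σ_c #{y : C x y = c} · r̄^{c,d}
--    (rowProj-by-colour).
--  * Affine independence: natural coefficients with a fixed sum are
--    determined by the combination Σ_c N_c · v_c (affine-coordinates-unique).
--
-- Colouring ⇒ tiling: assemble the patterns M̄^{C x y}; counting gives the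
-- projections.  Tiling ⇒ colouring: colour block (x , y) by the pattern it
-- imitates (second requirement); counting plus affine independence of the
-- T_1-projections of the patterns give the colour counts.  Columns are
-- handled by applying the row statements to transposed matrices.

open import Defs
open import Data.Nat using (ℕ; zero; suc; _+_; _*_; _≤_)
open import Data.Nat.Properties
  using (+-assoc; +-identityʳ; *-identityʳ; *-distribʳ-+; +-commutativeSemigroup)
open import Data.Integer as ℤ using (ℤ; +_; 0ℤ)
import Data.Integer.Properties as ℤP
import Data.Integer.Tactic.RingSolver as ℤSolver
open import Data.Fin using (Fin; zero; suc; toℕ; _≟_; combine; quotient; remainder; _↑ˡ_; _↑ʳ_)
open import Data.Fin.Properties
  using (combine-remQuot; remQuot-combine; toℕ-combine; toℕ-injective; combine-injectiveˡ)
open import Data.Bool using (if_then_else_)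
open import Data.Product using (Σ; ∃; _×_; _,_; proj₁; proj₂)
open import Data.Sum using (_⊎_; inj₁; inj₂)
open import Data.List.Membership.Propositional using (_∈_)
open import Relation.Nullary.Decidable using (⌊_⌋; yes; no)
open import Relation.Binary.PropositionalEquality
open import Function using (flip)
open import Function.Bundles using (_⇔_; mk⇔)
open import Algebra.Properties.CommutativeSemigroup +-commutativeSemigroup using (interchange)

sumFin-cong : ∀ {n} {f g : Fin n → ℕ} → (∀ i → f i ≡ g i) → sumFin f ≡ sumFin g
sumFin-cong {zero}  h = refl
sumFin-cong {suc n} h = cong₂ _+_ (h zero) (sumFin-cong (λ i → h (suc i)))

sumFin-zero : ∀ n → sumFin {n} (λ _ → 0) ≡ 0
sumFin-zero zero    = refl
sumFin-zero (suc n) = sumFin-zero n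

sumFin-distrib-+ : ∀ {n} (f g : Fin n → ℕ) →
  sumFin (λ i → f i + g i) ≡ sumFin f + sumFin g
sumFin-distrib-+ {zero}  f g = refl
sumFin-distrib-+ {suc n} f g =
  trans (cong (_+_ (f zero + g zero)) (sumFin-distrib-+ (λ i → f (suc i)) (λ i → g (suc i))))
        (interchange (f zero) (g zero) _ _)

sumFin-split : ∀ a b (f : Fin (a + b) → ℕ) →
  sumFin f ≡ sumFin (λ i → f (i ↑ˡ b)) + sumFin (λ j → f (a ↑ʳ j))
sumFin-split zero    b f = refl
sumFin-split (suc a) b f =
  trans (cong (_+_ (f zero)) (sumFin-split a b (λ i → f (suc i)))) (sym (+-assoc (f zero) _ _))

sumFin-combine : ∀ m k (f : Fin (m * k) → ℕ) →
  sumFin f ≡ sumFin (λ y → sumFin (λ j → f (combine {m} {k} y j)))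
sumFin-combine zero    k f = refl
sumFin-combine (suc m) k f =
  trans (sumFin-split k (m * k) f)
        (cong (_+_ (sumFin (λ j → f (j ↑ˡ (m * k))))) (sumFin-combine m k (λ i → f (k ↑ʳ i))))

indicator : ∀ {K} → Fin K → Fin K → ℕ
indicator a c = if ⌊ a ≟ c ⌋ then 1 else 0

colourCount : ∀ {n K} → (Fin n → Fin K) → Fin K → ℕ
colourCount f c = countFin (λ y → ⌊ f y ≟ c ⌋)

indicator-suc : ∀ {K} (a c : Fin K) → indicator (suc a) (suc c) ≡ indicator a c
indicator-suc a c with a ≟ c
... | yes _ = refl
... | no _  = refl

indicator-sum : ∀ {K} (a : Fin K) (g : Fin K → ℕ) → sumFin (λ c → indicator a c * g c) ≡ g a
indicator-sum {suc K} zero g = begin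
  (g zero + 0) + sumFin {K} (λ _ → 0) ≡⟨ cong₂ _+_ (+-identityʳ (g zero)) (sumFin-zero K) ⟩
  g zero + 0                          ≡⟨ +-identityʳ (g zero) ⟩
  g zero                              ∎
  where open ≡-Reasoning
indicator-sum (suc a) g =
  trans (sumFin-cong (λ c → cong (_* g (suc c)) (indicator-suc a c))) (indicator-sum a (λ c → g (suc c)))

sum-by-colour : ∀ {n K} (f : Fin n → Fin K) (g : Fin K → ℕ) →
  sumFin (λ y → g (f y)) ≡ sumFin (λ c → colourCount f c * g c)
sum-by-colour {zero} {K} f g = sym (sumFin-zero K)
sum-by-colour {suc n} f g = begin
  g (f zero) + sumFin (λ y → g (f (suc y)))
    ≡⟨ cong₂ _+_ (sym (indicator-sum (f zero) g)) (sum-by-colour (λ y → f (suc y)) g) ⟩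
  sumFin (λ c → indicator (f zero) c * g c) + sumFin (λ c → colourCount f′ c * g c)
    ≡⟨ sym (sumFin-distrib-+ (λ c → indicator (f zero) c * g c) (λ c → colourCount f′ c * g c)) ⟩
  sumFin (λ c → indicator (f zero) c * g c + colourCount f′ c * g c)
    ≡⟨ sumFin-cong (λ c → sym (*-distribʳ-+ (g c) (indicator (f zero) c) _)) ⟩
  sumFin (λ c → colourCount f c * g c) ∎
  where
  open ≡-Reasoning
  f′ : Fin n → Fin _
  f′ y = f (suc y)

colourCount-total : ∀ {n K} (f : Fin n → Fin K) → sumFin (colourCount f) ≡ n
colourCount-total {n} f = begin
  sumFin (colourCount f)                        ≡⟨ sumFin-cong (λ c → sym (*-identityʳ (colourCount f c))) ⟩
  sumFin (λ c → colourCount f c * 1)            ≡⟨ sym (sum-by-colour f (λ _ → 1)) ⟩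
  sumFin {n} (λ _ → 1)                          ≡⟨ ones n ⟩
  n                                             ∎
  where
  open ≡-Reasoning
  ones : ∀ n → sumFin {n} (λ _ → 1) ≡ n
  ones zero    = refl
  ones (suc n) = cong suc (ones n)

pos-sum₃ : (f : Color → ℕ) →
  + sumFin f ≡ + f zero ℤ.+ (+ f (suc zero) ℤ.+ (+ f (suc (suc zero)) ℤ.+ 0ℤ))
pos-sum₃ f =
  trans (ℤP.pos-+ (f zero) _) (cong (ℤ._+_ (+ f zero))
  (trans (ℤP.pos-+ (f (suc zero)) _) (cong (ℤ._+_ (+ f (suc zero)))
  (ℤP.pos-+ (f (suc (suc zero))) 0))))

difference-vanishes : (N R w : Color → ℕ) →
  sumFin (λ c → N c * w c) ≡ sumFin (λ c → R c * w c) →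
  let λc = λ c → + N c ℤ.- + R c in
  λc zero ℤ.* + w zero ℤ.+ λc (suc zero) ℤ.* + w (suc zero)
    ℤ.+ λc (suc (suc zero)) ℤ.* + w (suc (suc zero)) ≡ 0ℤ
difference-vanishes N R w eq = begin
  _ ≡⟨ expand (+ N c₀) (+ N c₁) (+ N c₂) (+ R c₀) (+ R c₁) (+ R c₂) (+ w c₀) (+ w c₁) (+ w c₂) ⟩
  dot N ℤ.- dot R ≡⟨ cong₂ ℤ._-_ (sym (pos-dot N)) (sym (pos-dot R)) ⟩
  + sumFin (λ c → N c * w c) ℤ.- + sumFin (λ c → R c * w c) ≡⟨ ℤP.i≡j⇒i-j≡0 (cong +_ eq) ⟩
  0ℤ ∎
  where
  open ≡-Reasoning
  c₀ c₁ c₂ : Color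
  c₀ = zero
  c₁ = suc zero
  c₂ = suc (suc zero)
  dot : (Color → ℕ) → ℤ
  dot a = + a c₀ ℤ.* + w c₀ ℤ.+ (+ a c₁ ℤ.* + w c₁ ℤ.+ (+ a c₂ ℤ.* + w c₂ ℤ.+ 0ℤ))
  pos-dot : (a : Color → ℕ) → + sumFin (λ c → a c * w c) ≡ dot a
  pos-dot a = trans (pos-sum₃ (λ c → a c * w c))
    (cong₂ ℤ._+_ (ℤP.pos-* (a c₀) _) (cong₂ ℤ._+_ (ℤP.pos-* (a c₁) _)
      (cong (ℤ._+ 0ℤ) (ℤP.pos-* (a c₂) _))))
  expand : ∀ n₀ n₁ n₂ r₀ r₁ r₂ w₀ w₁ w₂ →
    (n₀ ℤ.- r₀) ℤ.* w₀ ℤ.+ (n₁ ℤ.- r₁) ℤ.* w₁ ℤ.+ (n₂ ℤ.- r₂) ℤ.* w₂ ≡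
    (n₀ ℤ.* w₀ ℤ.+ (n₁ ℤ.* w₁ ℤ.+ (n₂ ℤ.* w₂ ℤ.+ 0ℤ)))
      ℤ.- (r₀ ℤ.* w₀ ℤ.+ (r₁ ℤ.* w₁ ℤ.+ (r₂ ℤ.* w₂ ℤ.+ 0ℤ)))
  expand = ℤSolver.solve-∀

affine-coordinates-unique : ∀ {ℓ} {v : Color → Fin ℓ → ℕ} → AffinelyIndependent3 v →
  (N R : Color → ℕ) → sumFin N ≡ sumFin R →
  (∀ i → sumFin (λ c → N c * v c i) ≡ sumFin (λ c → R c * v c i)) →
  ∀ c → N c ≡ R c
affine-coordinates-unique {v = v} independent N R total combination c =
  ℤP.+-injective (ℤP.i-j≡0⇒i≡j _ _ (independent λc sum-zero combination-zero c))
  where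
  λc : Color → ℤ
  λc c = + N c ℤ.- + R c
  unit-weights : ∀ a b c → a ℤ.* + 1 ℤ.+ b ℤ.* + 1 ℤ.+ c ℤ.* + 1 ≡ a ℤ.+ b ℤ.+ c
  unit-weights = ℤSolver.solve-∀
  sum-zero : λc zero ℤ.+ λc (suc zero) ℤ.+ λc (suc (suc zero)) ≡ 0ℤ
  sum-zero = trans (sym (unit-weights (λc zero) (λc (suc zero)) (λc (suc (suc zero))))) (difference-vanishes N R (λ _ → 1)
    (trans (sumFin-cong (λ c → *-identityʳ (N c)))
    (trans total (sumFin-cong (λ c → sym (*-identityʳ (R c)))))))
  combination-zero : ∀ i → λc zero ℤ.* + v zero i ℤ.+ λc (suc zero) ℤ.* + v (suc zero) i
                             ℤ.+ λc (suc (suc zero)) ℤ.* + v (suc (suc zero)) i ≡ 0ℤ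
  combination-zero i = difference-vanishes N R (λ c → v c i) (combination i)

all-combine : ∀ {m ℓ} {P : Fin (m * ℓ) → Set} → (∀ x i → P (combine x i)) → ∀ p → P p
all-combine {m} {ℓ} {P} h p = subst P (combine-remQuot {m} ℓ p) (h (quotient {m} ℓ p) (remainder {m} ℓ p))

assemble : ∀ {A : Set} {m n ℓ k} → (Fin m → Fin n → Fin ℓ → Fin k → A) →
  Fin (m * ℓ) → Fin (n * k) → A
assemble {m = m} {n} {ℓ} {k} F p q =
  F (quotient {m} ℓ p) (quotient {n} k q) (remainder {m} ℓ p) (remainder {n} k q)

assemble-combine : ∀ {A : Set} {m n ℓ k} (F : Fin m → Fin n → Fin ℓ → Fin k → A) x y i j →
  assemble F (combine x i) (combine y j) ≡ F x y i j
assemble-combine F x y i j =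
  cong₂ (λ u w → F (proj₁ u) (proj₁ w) (proj₂ u) (proj₂ w)) (remQuot-combine x i) (remQuot-combine y j)

origin : ∀ {m n} ℓ k → Fin m → Fin n → Cell
origin ℓ k x y = (+ (ℓ * toℕ x) , + (k * toℕ y))

pos-combine : ∀ {m n ℓ k} (x : Fin m) (y : Fin n) (i : Fin ℓ) (j : Fin k) →
  pos (combine x i) (combine y j) ≡ origin ℓ k x y +c pos i j
pos-combine x y i j = cong₂ _,_
  (trans (cong +_ (toℕ-combine x i)) (ℤP.pos-+ _ (toℕ i)))
  (trans (cong +_ (toℕ-combine y j)) (ℤP.pos-+ _ (toℕ j)))

pos-injective : ∀ {m n} {i i′ : Fin m} {j j′ : Fin n} → pos i j ≡ pos i′ j′ → i ≡ i′ × j ≡ j′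
pos-injective e =
  toℕ-injective (ℤP.+-injective (cong proj₁ e)) , toℕ-injective (ℤP.+-injective (cong proj₂ e))

translate-diff : ∀ o a b → (o +c a) -c (o +c b) ≡ a -c b
translate-diff (o₁ , o₂) (a₁ , a₂) (b₁ , b₂) = cong₂ _,_ (cancel o₁ a₁ b₁) (cancel o₂ a₂ b₂)
  where
  cancel : ∀ o a b → (o ℤ.+ a) ℤ.- (o ℤ.+ b) ≡ a ℤ.- b
  cancel = ℤSolver.solve-∀

translate-comm : ∀ t o a → t +c (o +c a) ≡ o +c (t +c a)
translate-comm (t₁ , t₂) (o₁ , o₂) (a₁ , a₂) = cong₂ _,_ (swap t₁ o₁ a₁) (swap t₂ o₂ a₂)
  where
  swap : ∀ t o a → t ℤ.+ (o ℤ.+ a) ≡ o ℤ.+ (t ℤ.+ a)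
  swap = ℤSolver.solve-∀

diff-add : ∀ a b → (a -c b) +c b ≡ a
diff-add (a₁ , a₂) (b₁ , b₂) = cong₂ _,_ (restore a₁ b₁) (restore a₂ b₂)
  where
  restore : ∀ a b → (a ℤ.- b) ℤ.+ b ≡ a
  restore = ℤSolver.solve-∀

lift-shift : ∀ {m n ℓ k} t (x : Fin m) (y : Fin n) {i i′ : Fin ℓ} {j j′ : Fin k} →
  t +c pos i j ≡ pos i′ j′ → t +c pos (combine x i) (combine y j) ≡ pos (combine x i′) (combine y j′)
lift-shift {ℓ = ℓ} {k} t x y {i} {i′} {j} {j′} e = begin
  t +c pos (combine x i) (combine y j) ≡⟨ cong (t +c_) (pos-combine x y i j) ⟩
  t +c (o +c pos i j)                  ≡⟨ translate-comm t o (pos i j) ⟩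
  o +c (t +c pos i j)                  ≡⟨ cong (o +c_) e ⟩
  o +c pos i′ j′                       ≡⟨ sym (pos-combine x y i′ j′) ⟩
  pos (combine x i′) (combine y j′)    ∎
  where
  open ≡-Reasoning
  o = origin ℓ k x y

offset-combine : ∀ {m n ℓ k} (x : Fin m) (y : Fin n) (i i′ : Fin ℓ) (j j′ : Fin k) →
  pos (combine x i) (combine y j) -c pos (combine x i′) (combine y j′) ≡ pos i j -c pos i′ j′
offset-combine {ℓ = ℓ} {k} x y i i′ j j′ =
  trans (cong₂ _-c_ (pos-combine x y i j) (pos-combine x y i′ j′))
        (translate-diff (origin ℓ k x y) (pos i j) (pos i′ j′))

CoveredBy-cong : ∀ {K m n m′ n′} {T : Fin K → Tile}
  {M : Fin m → Fin n → Fin (suc K)} {M′ : Fin m′ → Fin n′ → Fin (suc K)} {c c′ p q p′ q′} →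
  M p q ≡ M′ p′ q′ → c -c pos p q ≡ c′ -c pos p′ q′ →
  CoveredBy T M c p q → CoveredBy T M′ c′ p′ q′
CoveredBy-cong {T = T} entry offset (d , placed , member) =
  d , trans (sym entry) placed , subst (λ t → t ∈ cells (T d)) offset member

module Assembly {K m n ℓ k} (T : Fin K → Tile)
  (F : Fin m → Fin n → Fin ℓ → Fin k → Fin (suc K))
  (tilings : ∀ x y → IsTiling ℓ k T (F x y)) where

  M : Fin (m * ℓ) → Fin (n * k) → Fin (suc K)
  M = assemble F

  lift-cover : ∀ x y {i j i′ j′} →
    CoveredBy T (F x y) (pos i j) i′ j′ →
    CoveredBy T M (pos (combine x i) (combine y j)) (combine x i′) (combine y j′)
  lift-cover x y {i} {j} {i′} {j′} =
    CoveredBy-cong {T = T} {M = F x y} {M′ = M}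
      {c = pos i j} {c′ = pos (combine x i) (combine y j)}
      {p = i′} {q = j′} {p′ = combine x i′} {q′ = combine y j′}
      (sym (assemble-combine F x y i′ j′)) (sym (offset-combine x y i i′ j j′))

  restrict-cover : ∀ x y {i j i′ j′} →
    CoveredBy T M (pos (combine x i) (combine y j)) (combine x i′) (combine y j′) →
    CoveredBy T (F x y) (pos i j) i′ j′
  restrict-cover x y {i} {j} {i′} {j′} =
    CoveredBy-cong {T = T} {M = M} {M′ = F x y}
      {c = pos (combine x i) (combine y j)} {c′ = pos i j}
      {p = combine x i′} {q = combine y j′} {p′ = i′} {q′ = j′}
      (assemble-combine F x y i′ j′) (offset-combine x y i i′ j j′)

  same-block : ∀ x y i j x′ y′ i′ j′ →
    CoveredBy T M (pos (combine x i) (combine y j)) (combine x′ i′) (combine y′ j′) →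
    x′ ≡ x × y′ ≡ y
  same-block x y i j x′ y′ i′ j′ (d , placed , member)
    with proj₁ (tilings x′ y′) i′ j′ d (trans (sym (assemble-combine F x′ y′ i′ j′)) placed) _ member
  ... | i″ , j″ , landed =
    sym (combine-injectiveˡ x i x′ i″ (proj₁ equal-cells)) ,
    sym (combine-injectiveˡ y j y′ j″ (proj₂ equal-cells))
    where
    c  = pos (combine x i) (combine y j)
    c′ = pos (combine x′ i′) (combine y′ j′)
    equal-cells = pos-injective (trans (sym (diff-add c c′)) (lift-shift (c -c c′) x′ y′ landed))

  inside : ∀ p q (d : Fin K) → M p q ≡ suc d →
    ∀ t → t ∈ cells (T d) → InGrid (m * ℓ) (n * k) (t +c pos p q)
  inside = all-combine λ x i → all-combine λ y j d placed t member →
    let i′ , j′ , landed = proj₁ (tilings x y) i j d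
                             (trans (sym (assemble-combine F x y i j)) placed) t member
    in combine x i′ , combine y j′ , lift-shift t x y landed

  Unique : Cell → Fin (m * ℓ) → Fin (n * k) → Set
  Unique c p q = ∀ p′ q′ → CoveredBy T M c p′ q′ → (p′ ≡ p) × (q′ ≡ q)

  -- every cell is covered by the tile covering it inside its block, and by
  -- no other tile since tiles stay in their blocks
  covered : ∀ (a : Fin (m * ℓ)) (b : Fin (n * k)) →
    Σ (Fin (m * ℓ)) λ p → Σ (Fin (n * k)) λ q → CoveredBy T M (pos a b) p q × Unique (pos a b) p q
  covered = all-combine λ x i → all-combine λ y j →
    let i₀ , j₀ , cover , unique = proj₂ (tilings x y) i j in
    combine x i₀ , combine y j₀ , lift-cover x y cover ,
    all-combine λ x′ i′ → all-combine λ y′ j′ cover′ → unique-in-block x′ i′ y′ j′ cover′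
      (same-block x y i j x′ y′ i′ j′ cover′) unique
    where
    unique-in-block : ∀ {x y i j i₀ j₀} x′ i′ y′ j′ →
      CoveredBy T M (pos (combine x i) (combine y j)) (combine x′ i′) (combine y′ j′) →
      x′ ≡ x × y′ ≡ y →
      (∀ i″ j″ → CoveredBy T (F x y) (pos i j) i″ j″ → (i″ ≡ i₀) × (j″ ≡ j₀)) →
      (combine x′ i′ ≡ combine x i₀) × (combine y′ j′ ≡ combine y j₀)
    unique-in-block x′ i′ y′ j′ cover′ (refl , refl) unique =
      let same-i , same-j = unique i′ j′ (restrict-cover x′ y′ cover′)
      in cong (combine x′) same-i , cong (combine y′) same-j

assemble-tiling : ∀ {K m n ℓ k} (T : Fin K → Tile)
  (F : Fin m → Fin n → Fin ℓ → Fin k → Fin (suc K)) →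
  (∀ x y → IsTiling ℓ k T (F x y)) → IsTiling (m * ℓ) (n * k) T (assemble F)
assemble-tiling T F tilings = inside , covered
  where open Assembly T F tilings

rowProj-cong : ∀ {K m n} {A B : Fin m → Fin n → Fin (suc K)} →
  (∀ i j → A i j ≡ B i j) → ∀ d i → rowProj A d i ≡ rowProj B d i
rowProj-cong e d i = sumFin-cong (λ j → cong (λ t → if ⌊ t ≟ suc d ⌋ then 1 else 0) (e i j))

rowProj-by-colour : ∀ {K K′ m n ℓ k} (M : Fin (m * ℓ) → Fin (n * k) → Fin (suc K))
  (B : Fin K′ → Fin ℓ → Fin k → Fin (suc K)) (C : Fin m → Fin n → Fin K′) d x i →
  (∀ y → rowProj (block {m = m} {n = n} M x y) d i ≡ rowProj (B (C x y)) d i) →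
  rowProj M d (combine x i) ≡ sumFin (λ c → colourCount (C x) c * rowProj (B c) d i)
rowProj-by-colour {n = n} {k = k} M B C d x i blocks = begin
  rowProj M d (combine x i)                                 ≡⟨ sumFin-combine n k _ ⟩
  sumFin (λ y → rowProj (block {n = n} M x y) d i)          ≡⟨ sumFin-cong blocks ⟩
  sumFin (λ y → rowProj (B (C x y)) d i)                    ≡⟨ sum-by-colour (C x) (λ c → rowProj (B c) d i) ⟩
  sumFin (λ c → colourCount (C x) c * rowProj (B c) d i)    ∎
  where open ≡-Reasoning

bigRow-combine : ∀ {m ℓ} (r : Color → Fin m → ℕ) (rb : Color → Fin 2 → Fin ℓ → ℕ) d x i →
  bigRow r rb d (combine x i) ≡ sumFin (λ c → r c x * rb c d i)
bigRow-combine r rb d x i = cong (λ u → sumFin (λ c → r c (proj₁ u) * rb c d (proj₂ u))) (remQuot-combine x i)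

rows-from-colouring : ∀ {m n ℓ k} (C : Fin m → Fin n → Color) (B : Color → Fin ℓ → Fin k → Fin 3)
  (r : Color → Fin m → ℕ) → (∀ c x → colourCount (C x) c ≡ r c x) →
  ∀ d p → rowProj (assemble (λ x y → B (C x y))) d p ≡ bigRow r (λ c → rowProj (B c)) d p
rows-from-colouring {m} {n} {ℓ} {k} C B r counts d = all-combine λ x i → begin
  rowProj M d (combine x i)
    ≡⟨ rowProj-by-colour M B C d x i (λ y → rowProj-cong (assemble-combine F x y) d i) ⟩
  sumFin (λ c → colourCount (C x) c * rowProj (B c) d i)
    ≡⟨ sumFin-cong (λ c → cong (_* rowProj (B c) d i) (counts c x)) ⟩
  sumFin (λ c → r c x * rowProj (B c) d i)
    ≡⟨ sym (bigRow-combine r (λ c → rowProj (B c)) d x i) ⟩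
  bigRow r (λ c → rowProj (B c)) d (combine x i) ∎
  where
  open ≡-Reasoning
  F : Fin m → Fin n → Fin ℓ → Fin k → Fin 3
  F x y = B (C x y)
  M = assemble F

counts-from-tiling : ∀ {m n ℓ k} (M : Fin (m * ℓ) → Fin (n * k) → Fin 3)
  (B : Color → Fin ℓ → Fin k → Fin 3) (r : Color → Fin m → ℕ) (C : Fin m → Fin n → Color) →
  (∀ x → sumFin (λ c → r c x) ≡ n) →
  (∀ p → rowProj M zero p ≡ bigRow r (λ c → rowProj (B c)) zero p) →
  (∀ x y i → rowProj (block {m = m} {n = n} M x y) zero i ≡ rowProj (B (C x y)) zero i) →
  AffinelyIndependent3 (λ c → rowProj (B c) zero) →
  ∀ c x → colourCount (C x) c ≡ r c x
counts-from-tiling M B r C rowSums rows blocks independent c x =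
  affine-coordinates-unique {v = λ c → rowProj (B c) zero} independent (colourCount (C x)) (λ c → r c x)
    (trans (colourCount-total (C x)) (sym (rowSums x))) combination c
  where
  combination : ∀ i → sumFin (λ c → colourCount (C x) c * rowProj (B c) zero i)
                    ≡ sumFin (λ c → r c x * rowProj (B c) zero i)
  combination i =
    trans (sym (rowProj-by-colour M B C zero x i (λ y → blocks x y i)))
    (trans (rows (combine x i)) (bigRow-combine r (λ c → rowProj (B c)) zero x i))

projections-agree : ∀ {K m n} {A B : Fin m → Fin n → Fin (suc K)} →
  (∀ i j → A i j ≡ B i j) ⊎
    ((∀ d i → rowProj A d i ≡ rowProj B d i) × (∀ d j → colProj A d j ≡ colProj B d j)) →
  (∀ d i → rowProj A d i ≡ rowProj B d i) × (∀ d j → colProj A d j ≡ colProj B d j)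
projections-agree (inj₁ e)     = rowProj-cong e , rowProj-cong (λ j i → e i j)
projections-agree (inj₂ equal) = equal

-- transposed matrices (colProj M = rowProj (flip M) definitionally).

lemma6 : (T : Fin 2 → Tile) (ℓ k : ℕ) → 1 ≤ ℓ → 1 ≤ k →
    (Mb : Color → Fin ℓ → Fin k → Fin 3) →
    (∀ c → IsTiling ℓ k T (Mb c)) →
    AffinelyIndependent3 (λ c → rowProj (Mb c) zero) →
    AffinelyIndependent3 (λ c → colProj (Mb c) zero) →
    (m n : ℕ) (r : Color → Fin m → ℕ) (s : Color → Fin n → ℕ) →
    Is3ColorInstance m n r s →
    (∀ (M : Fin (m * ℓ) → Fin (n * k) → Fin 3) →
       IsTilingSolution (m * ℓ) (n * k) T
         (bigRow r (λ c → rowProj (Mb c))) (bigCol s (λ c → colProj (Mb c))) M →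
       ∀ x y → Σ Color λ c →
         (∀ i j → block {m = m} {n = n} M x y i j ≡ Mb c i j)
         ⊎ ((∀ d i → rowProj (block {m = m} {n = n} M x y) d i ≡ rowProj (Mb c) d i)
            × (∀ d j → colProj (block {m = m} {n = n} M x y) d j ≡ colProj (Mb c) d j))) →
    (∃ λ (M : Fin (m * ℓ) → Fin (n * k) → Fin 3) →
       IsTilingSolution (m * ℓ) (n * k) T
         (bigRow r (λ c → rowProj (Mb c))) (bigCol s (λ c → colProj (Mb c))) M)
    ⇔ (∃ λ (M : Fin m → Fin n → Color) → Is3ColorSolution m n r s M)
lemma6 T ℓ k _ _ Mb tilings rowsIndependent colsIndependent m n r s (rowSums , colSums , _) imitates =
  mk⇔ toColouring toTiling
  where
  TilingSolution : Set
  TilingSolution = ∃ λ (M : Fin (m * ℓ) → Fin (n * k) → Fin 3) →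
    IsTilingSolution (m * ℓ) (n * k) T
      (bigRow r (λ c → rowProj (Mb c))) (bigCol s (λ c → colProj (Mb c))) M

  ColouringSolution : Set
  ColouringSolution = ∃ λ (C : Fin m → Fin n → Color) → Is3ColorSolution m n r s C

  toColouring : TilingSolution → ColouringSolution
  toColouring (M , solution@(_ , rows , cols)) =
    C , counts-from-tiling M Mb r C rowSums (rows zero) (λ x y → proj₁ (agree x y) zero) rowsIndependent
      , counts-from-tiling {n} {m} {k} {ℓ} (flip M) (λ c → flip (Mb c)) s (flip C) colSums
          (cols zero) (λ y x → proj₂ (agree x y) zero) colsIndependent
    where
    C : Fin m → Fin n → Color
    C x y = proj₁ (imitates M solution x y)
    agree : ∀ x y →
      (∀ d i → rowProj (block {m = m} {n = n} M x y) d i ≡ rowProj (Mb (C x y)) d i) ×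
      (∀ d j → colProj (block {m = m} {n = n} M x y) d j ≡ colProj (Mb (C x y)) d j)
    agree x y = projections-agree (proj₂ (imitates M solution x y))

  toTiling : ColouringSolution → TilingSolution
  toTiling (C , rowCounts , colCounts) =
    assemble (λ x y → Mb (C x y)) , assemble-tiling T (λ x y → Mb (C x y)) (λ x y → tilings (C x y)) ,
    rows-from-colouring C Mb r rowCounts ,
    rows-from-colouring {n} {m} {k} {ℓ} (flip C) (λ c → flip (Mb c)) s colCounts
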